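{- For every $\ell\ge3$, the sequence of words produced by the tape machine $\mathcal T_1$ (defined below) on length $\ell$ is exactly the sequence $B_\ell$ (defined below). $\mathcal T_1$ has states $\{q_{\mathrm i},\uparrow,\downarrow,q_{\mathrm h}\}$, initial state $q_{\mathrm i}$, halting state $q_{\mathrm h}$, and all four states are output states. Index tape cells $0,\dots,\ell+1$ (cell $0$ holds $\triangleright$, cell $\ell+1$ holds $\triangleleft$), let $h$ be the head position, and for a bit $x$ let $\bar x=1-x$. Its (macro-)transitions are: (1) in $q_{\mathrm i}$, if cell $h-1$ is $\triangleright$, cell $h$ is $0$ and cell $h+1$ is $0$: set cell $h+1$ to $1$, move head to $h+1$, go to $\downarrow$; (2) in $\downarrow$, if cell $h-2\in\{0,1,\triangleright\}$, cell $h-1\in\{0,1\}$, cell $h$ is $1$ and cell $h+1$ is $0$: set cell $h+1$ to $1$, move head to $h+1$, stay in $\downarrow$; (3) in $\downarrow$, if cell $h-2\in\{0,1,\triangleright\}$, cell $h-1$ holds a bit $x$, cell $h$ is $1$ and cell $h+1$ is $\triangleleft$: set cell $h-1$ to $\bar x$, head stays, go to $\uparrow$; (4) in $\uparrow$, if cell $h-2$ holds a bit $x$, cell $h-1$ is $0$, cell $h$ is $1$ and cell $h+1\in\{0,\triangleleft\}$: set cell $h-2$ to $\bar x$, head stays, go to $\downarrow$; (5) in $\uparrow$, if cell $h-2\in\{0,1\}$, cell $h-1$ is $1$, cell $h$ is $1$ and cell $h+1\in\{0,\triangleleft\}$: set cell $h$ to $0$, move head to $h-1$, stay in $\uparrow$;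 (6) in $\uparrow$, if cell $h-2$ is $\triangleright$, cell $h-1$ is $1$, cell $h$ is $1$ and cell $h+1$ is $0$: set cell $h$ to $0$, move head to $h-1$, go to $q_{\mathrm h}$.
   Context: Tape machine semantics: the tape is $\triangleright w\triangleleft$ with $w\in\{0,1\}^\ell$, the run for length $\ell$ starts in state $q_{\mathrm i}$ with $w=0^\ell$ and the head on cell $1$, applies the (macro-)transitions above (each reads and rewrites a constant window of cells around the head and moves the head by at most one cell), and stops on reaching $q_{\mathrm h}$; whenever the current state is an output state the current word $w$ is produced, so the produced words form a finite sequence. Sequences $B_\ell$: for a sequence of words $X=(w_1,\dots,w_p)$ let $\overleftarrow{X}=(w_p,\dots,w_1)$, $X[1{:}]=(w_2,\dots,w_p)$, and $uX=(uw_1,\dots,uw_p)$ for a word $u$. Let $B_1=(0,1)$ and for $\ell\ge1$ let $B_{\ell+1}$ be the concatenation of $(0^{\ell+1})$, $0\,\overleftarrow{B_\ell[1{:}]}$, $1\,B_\ell[1{:}]$, and $(10^\ell)$. -}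

module Defs where

open import Data.Nat using (ℕ; zero; suc; _+_; _∸_)
open import Data.Bool using (Bool; true; false; not)
open import Data.List using (List; []; _∷_; _++_; map; reverse; drop; replicate; [_])
open import Data.Maybe using (Maybe; just; nothing)
open import Data.Product using (_×_; _,_)

-- Bits: 0 = false, 1 = true.  A word w ∈ {0,1}^ℓ is a List Bool of length ℓ.

-- Bs k = B_(k+1)
Bs : ℕ → List (List Bool)
Bs zero = (false ∷ []) ∷ (true ∷ []) ∷ []
Bs (suc k) =
  (replicate (suc (suc k)) false ∷ [])
  ++ map (false ∷_) (reverse (drop 1 (Bs k)))
  ++ map (true ∷_) (drop 1 (Bs k))
  ++ [ true ∷ replicate (suc k) false ]

-- B ℓ = B_ℓ for ℓ ≥ 1 (B 0 is an unused dummy value)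
B : ℕ → List (List Bool)
B zero = []
B (suc k) = Bs k

-- Tape: ▷ w ◁, cells indexed 0 .. ℓ+1

data Cell : Set where
  lend : Cell
  rend : Cell
  bit  : Bool → Cell

-- content of cell (i+1), i.e. position i of w, or ◁ right after w
cellAt' : List Bool → ℕ → Maybe Cell
cellAt' [] zero = just rend
cellAt' [] (suc _) = nothing
cellAt' (x ∷ xs) zero = just (bit x)
cellAt' (x ∷ xs) (suc i) = cellAt' xs i

cellAt : List Bool → ℕ → Maybe Cell
cellAt w zero = just lend
cellAt w (suc i) = cellAt' w i

cellBack : List Bool → ℕ → ℕ → Maybe Cell
cellBack w h zero = cellAt w h
cellBack w zero (suc k) = nothing
cellBack w (suc h) (suc k) = cellBack w h k

upd : List Bool → ℕ → Bool → List Bool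
upd [] _ _ = []
upd (x ∷ xs) zero b = b ∷ xs
upd (x ∷ xs) (suc i) b = x ∷ upd xs i b

-- set tape cell j (j ≥ 1, a bit cell) to b
setCell : List Bool → ℕ → Bool → List Bool
setCell w zero b = w
setCell w (suc i) b = upd w i b

data State : Set where
  qi down up qh : State

-- configuration: state, word w, head position h
Config : Set
Config = State × List Bool × ℕ

stepT₁ : State → List Bool → ℕ → Maybe Config
stepT₁ qi w h with cellBack w h 1 | cellAt w h | cellAt w (suc h)
... | just lend | just (bit false) | just (bit false) = just (down , setCell w (suc h) true , suc h)
... | _ | _ | _ = nothing
stepT₁ down w h with cellBack w h 2 | cellBack w h 1 | cellAt w h | cellAt w (suc h)
... | just (bit _) | just (bit _) | just (bit true) | just (bit false) = just (down , setCell w (suc h) true , suc h)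
... | just lend    | just (bit _) | just (bit true) | just (bit false) = just (down , setCell w (suc h) true , suc h)
... | just (bit _) | just (bit x) | just (bit true) | just rend = just (up , setCell w (h ∸ 1) (not x) , h)
... | just lend    | just (bit x) | just (bit true) | just rend = just (up , setCell w (h ∸ 1) (not x) , h)
... | _ | _ | _ | _ = nothing
stepT₁ up w h with cellBack w h 2 | cellBack w h 1 | cellAt w h | cellAt w (suc h)
... | just (bit x) | just (bit false) | just (bit true) | just (bit false) = just (down , setCell w (h ∸ 2) (not x) , h)
... | just (bit x) | just (bit false) | just (bit true) | just rend = just (down , setCell w (h ∸ 2) (not x) , h)
... | just (bit _) | just (bit true) | just (bit true) | just (bit false) = just (up , setCell w h false , h ∸ 1)
... | just (bit _) | just (bit true) | just (bit true) | just rend = just (up , setCell w h false , h ∸ 1)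
... | just lend | just (bit true) | just (bit true) | just (bit false) = just (qh , setCell w h false , h ∸ 1)
... | _ | _ | _ | _ = nothing
stepT₁ qh w h = nothing

-- All states are output states, so the word of every
-- visited configuration is produced.
runT₁ : ℕ → Config → Maybe (List (List Bool))
runT₁ zero _ = nothing
runT₁ (suc n) (qh , w , h) = just (w ∷ [])
runT₁ (suc n) (s , w , h) with stepT₁ s w h
... | nothing = nothing
... | just c with runT₁ n c
...   | nothing = nothing
...   | just ws = just (w ∷ ws)

initT₁ : ℕ → Config
initT₁ ℓ = (qi , replicate ℓ false , 1)

-- B_(a+2) is 0^(a+2) followed by T_(a+1), where T_a is the tail of B_(a+1); T_(a+1) is
-- 0·rev(T_a), 1·T_a, 1 0^(a+1), running from 0 1 0^a to 1 0^(a+1).  Behind a fixed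
-- prefix, with the head on the first 1 of the suffix, the machine traverses T_(a+1)
-- forwards (entering in ↓, leaving in ↑) or backwards, recursively: forwards is a
-- backward traversal of T_a behind 0, a flip (4) of that 0 to 1, a forward traversal
-- behind 1 and a retraction (5); backwards is an extension (2), a backward traversal
-- behind 1, a flip of that 1 to 0 and a forward traversal behind 0.  Transition (3)
-- turns around at ◁ in the base case, and the whole run is the forward traversal of
-- T_(ℓ-1) behind the empty prefix, opened by (1) and closed by (6) instead of (5).
module Submission where

open import Defs
open import Data.Nat using (ℕ; _≤_)
open import Data.Maybe using (just)
open import Data.Product using (∃-syntax)
open import Relation.Binary.PropositionalEquality using (_≡_)

open import Data.Bool using (Bool; true; false; not)
open import Data.List using (List; []; _∷_; _++_; _∷ʳ_; [_]; _ʳ++_; map; reverse; drop; replicate; length)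
open import Data.List.Properties using (++-assoc; map-++; map-∘; map-id; reverse-++; reverse-map; reverse-involutive)
open import Data.Maybe using (Maybe)
open import Data.Nat using (zero; suc; _+_; _∸_; s≤s)
open import Data.Nat.Properties using (+-suc; +-identityʳ)
open import Data.Product using (_,_; map₂)
open import Data.Sum using (_⊎_; inj₁; inj₂)
open import Function using (id; _∘_)
open import Relation.Binary.PropositionalEquality using (refl; sym; trans; cong; cong₂; subst; module ≡-Reasoning)

zeros : ℕ → List Bool
zeros n = replicate n false

tailBs : ℕ → List (List Bool)
tailBs a = drop 1 (Bs a)

firstTail lastTail : ℕ → List Bool
firstTail a = false ∷ true ∷ zeros a
lastTail a = true ∷ zeros (suc a)

reverse-tailBs-suc : ∀ a → reverse (tailBs (suc a)) ≡
  lastTail a ∷ map (true ∷_) (reverse (tailBs a)) ++ map (false ∷_) (tailBs a)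
reverse-tailBs-suc a = begin
  reverse (map (false ∷_) (reverse T) ++ map (true ∷_) T ++ [ lastTail a ])
    ≡⟨ reverse-++ (map (false ∷_) (reverse T)) _ ⟩
  reverse (map (true ∷_) T ++ [ lastTail a ]) ++ reverse (map (false ∷_) (reverse T))
    ≡⟨ cong₂ _++_ (reverse-++ (map (true ∷_) T) _) (sym (reverse-map _ (reverse T))) ⟩
  lastTail a ∷ reverse (map (true ∷_) T) ++ map (false ∷_) (reverse (reverse T))
    ≡⟨ cong₂ (λ u v → lastTail a ∷ u ++ map (false ∷_) v) (sym (reverse-map _ T)) (reverse-involutive T) ⟩
  lastTail a ∷ map (true ∷_) (reverse T) ++ map (false ∷_) T
    ∎
  where
  open ≡-Reasoning
  T : List (List Bool)
  T = tailBs a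

map-∷-++ : ∀ (f : List Bool → List Bool) b c xs ys →
  map (f ∘ (b ∷_)) xs ++ map (f ∘ (c ∷_)) ys ≡ map f (map (b ∷_) xs ++ map (c ∷_) ys)
map-∷-++ f b c xs ys =
  trans (cong₂ _++_ (map-∘ {g = f} {f = b ∷_} xs) (map-∘ {g = f} {f = c ∷_} ys)) (sym (map-++ f (map (b ∷_) xs) (map (c ∷_) ys)))

-- The words shown while traversing tailBs (suc a) backwards, resp. forwards, behind
-- the context f, without the final word.
revTrace fwdTrace : (List Bool → List Bool) → ℕ → List (List Bool)
revTrace f zero = f (lastTail zero) ∷ f (true ∷ true ∷ []) ∷ []
revTrace f (suc a) =
  f (lastTail (suc a)) ∷ (revTrace (f ∘ (true ∷_)) a ∷ʳ f (true ∷ firstTail a)) ++ fwdTrace (f ∘ (false ∷_)) a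
fwdTrace f zero = f (firstTail zero) ∷ f (true ∷ true ∷ []) ∷ []
fwdTrace f (suc a) =
  (revTrace (f ∘ (false ∷_)) a ∷ʳ f (false ∷ firstTail a)) ++ (fwdTrace (f ∘ (true ∷_)) a ∷ʳ f (true ∷ lastTail a))

revTrace-∷ʳ : ∀ f a → revTrace f a ∷ʳ f (firstTail a) ≡ map f (reverse (tailBs (suc a)))
fwdTrace-∷ʳ : ∀ f a → fwdTrace f a ∷ʳ f (lastTail a) ≡ map f (tailBs (suc a))
revTrace-∷ʳ f zero = refl
revTrace-∷ʳ f (suc a) = begin
  f (lastTail (suc a)) ∷ ((R ∷ʳ f₁ (firstTail a)) ++ F) ∷ʳ f₀ (lastTail a)
    ≡⟨ cong (f (lastTail (suc a)) ∷_) (++-assoc (R ∷ʳ _) F _) ⟩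
  f (lastTail (suc a)) ∷ (R ∷ʳ f₁ (firstTail a)) ++ (F ∷ʳ f₀ (lastTail a))
    ≡⟨ cong (f (lastTail (suc a)) ∷_) (cong₂ _++_ (revTrace-∷ʳ f₁ a) (fwdTrace-∷ʳ f₀ a)) ⟩
  f (lastTail (suc a)) ∷ map f₁ (reverse T) ++ map f₀ T
    ≡⟨ cong (f (lastTail (suc a)) ∷_) (map-∷-++ f true false (reverse T) T) ⟩
  map f (lastTail (suc a) ∷ map (true ∷_) (reverse T) ++ map (false ∷_) T)
    ≡⟨ cong (map f) (sym (reverse-tailBs-suc (suc a))) ⟩
  map f (reverse (tailBs (suc (suc a))))
    ∎
  where
  open ≡-Reasoning
  f₀ f₁ : List Bool → List Bool
  f₀ = f ∘ (false ∷_)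
  f₁ = f ∘ (true ∷_)
  T R F : List (List Bool)
  T = tailBs (suc a)
  R = revTrace f₁ a
  F = fwdTrace f₀ a
fwdTrace-∷ʳ f zero = refl
fwdTrace-∷ʳ f (suc a) = begin
  ((R ∷ʳ f₀ (firstTail a)) ++ (F ∷ʳ f₁ (lastTail a))) ∷ʳ f (lastTail (suc a))
    ≡⟨ ++-assoc (R ∷ʳ _) (F ∷ʳ _) _ ⟩
  (R ∷ʳ f₀ (firstTail a)) ++ (F ∷ʳ f₁ (lastTail a)) ++ [ f (lastTail (suc a)) ]
    ≡⟨ cong₂ (λ u v → u ++ v ++ [ f (lastTail (suc a)) ]) (revTrace-∷ʳ f₀ a) (fwdTrace-∷ʳ f₁ a) ⟩
  map f₀ (reverse T) ++ map f₁ T ++ [ f (lastTail (suc a)) ]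
    ≡⟨ sym (++-assoc (map f₀ (reverse T)) _ _) ⟩
  (map f₀ (reverse T) ++ map f₁ T) ++ [ f (lastTail (suc a)) ]
    ≡⟨ cong (_++ [ f (lastTail (suc a)) ]) (map-∷-++ f false true (reverse T) T) ⟩
  map f (map (false ∷_) (reverse T) ++ map (true ∷_) T) ++ map f [ lastTail (suc a) ]
    ≡⟨ sym (map-++ f (map (false ∷_) (reverse T) ++ map (true ∷_) T) _) ⟩
  map f ((map (false ∷_) (reverse T) ++ map (true ∷_) T) ++ [ lastTail (suc a) ])
    ≡⟨ cong (map f) (++-assoc (map (false ∷_) (reverse T)) _ _) ⟩
  map f (tailBs (suc (suc a)))
    ∎
  where
  open ≡-Reasoning
  f₀ f₁ : List Bool → List Bool
  f₀ = f ∘ (false ∷_)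
  f₁ = f ∘ (true ∷_)
  T R F : List (List Bool)
  T = tailBs (suc a)
  R = revTrace f₀ a
  F = fwdTrace f₁ a

-- The word of the target configuration c′ is not among the words ws.
_↝⟨_⟩_ : Config → List (List Bool) → Config → Set
c ↝⟨ ws ⟩ c′ = ∀ {rest} → ∃[ n ] runT₁ n c′ ≡ just rest → ∃[ n ] runT₁ n c ≡ just (ws ++ rest)

infixr 4 _⨾_

_⨾_ : ∀ {c c′ c″ ws ws′} → c ↝⟨ ws ⟩ c′ → c′ ↝⟨ ws′ ⟩ c″ → c ↝⟨ ws ++ ws′ ⟩ c″
_⨾_ {ws = ws} {ws′} first second halts =
  map₂ (λ run → trans run (cong just (sym (++-assoc ws ws′ _)))) (first (second halts))

runT₁-step : ∀ {s w h c n ws} → stepT₁ s w h ≡ just c → runT₁ n c ≡ just ws →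
  runT₁ (suc n) (s , w , h) ≡ just (w ∷ ws)
runT₁-step {qi} step run rewrite step | run = refl
runT₁-step {down} step run rewrite step | run = refl
runT₁-step {up} step run rewrite step | run = refl
runT₁-step {qh} () _

step↝ : ∀ {s w h c} → stepT₁ s w h ≡ just c → (s , w , h) ↝⟨ [ w ] ⟩ c
step↝ {s} {w} {h} step (n , run) = suc n , runT₁-step {s} {w} {h} step run

LendOrBit : Maybe Cell → Set
LendOrBit m = m ≡ just lend ⊎ ∃[ b ] m ≡ just (bit b)

ZeroOrRend : Maybe Cell → Set
ZeroOrRend m = m ≡ just (bit false) ⊎ m ≡ just rend

rule₂ : ∀ w h {y} → LendOrBit (cellBack w h 2) → cellBack w h 1 ≡ just (bit y) →
  cellAt w h ≡ just (bit true) → cellAt w (suc h) ≡ just (bit false) →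
  stepT₁ down w h ≡ just (down , setCell w (suc h) true , suc h)
rule₂ w h (inj₁ e₂) e₁ e₀ e₋₁ rewrite e₂ | e₁ | e₀ | e₋₁ = refl
rule₂ w h (inj₂ (_ , e₂)) e₁ e₀ e₋₁ rewrite e₂ | e₁ | e₀ | e₋₁ = refl

rule₃ : ∀ w h {x y} → cellBack w h 2 ≡ just (bit x) → cellBack w h 1 ≡ just (bit y) →
  cellAt w h ≡ just (bit true) → cellAt w (suc h) ≡ just rend →
  stepT₁ down w h ≡ just (up , setCell w (h ∸ 1) (not y) , h)
rule₃ w h e₂ e₁ e₀ e₋₁ rewrite e₂ | e₁ | e₀ | e₋₁ = refl

rule₄ : ∀ w h {x} → cellBack w h 2 ≡ just (bit x) → cellBack w h 1 ≡ just (bit false) →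
  cellAt w h ≡ just (bit true) → ZeroOrRend (cellAt w (suc h)) →
  stepT₁ up w h ≡ just (down , setCell w (h ∸ 2) (not x) , h)
rule₄ w h e₂ e₁ e₀ (inj₁ e₋₁) rewrite e₂ | e₁ | e₀ | e₋₁ = refl
rule₄ w h e₂ e₁ e₀ (inj₂ e₋₁) rewrite e₂ | e₁ | e₀ | e₋₁ = refl

rule₅ : ∀ w h {x} → cellBack w h 2 ≡ just (bit x) → cellBack w h 1 ≡ just (bit true) →
  cellAt w h ≡ just (bit true) → ZeroOrRend (cellAt w (suc h)) →
  stepT₁ up w h ≡ just (up , setCell w h false , h ∸ 1)
rule₅ w h e₂ e₁ e₀ (inj₁ e₋₁) rewrite e₂ | e₁ | e₀ | e₋₁ = refl
rule₅ w h e₂ e₁ e₀ (inj₂ e₋₁) rewrite e₂ | e₁ | e₀ | e₋₁ = refl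

cellAt′-ʳ++ : ∀ r t i → cellAt' (r ʳ++ t) (i + length r) ≡ cellAt' t i
cellAt′-ʳ++ [] t i rewrite +-identityʳ i = refl
cellAt′-ʳ++ (x ∷ r) t i rewrite +-suc i (length r) = cellAt′-ʳ++ r (x ∷ t) (suc i)

upd-ʳ++ : ∀ r t i b → upd (r ʳ++ t) (i + length r) b ≡ r ʳ++ upd t i b
upd-ʳ++ [] t i b rewrite +-identityʳ i = refl
upd-ʳ++ (x ∷ r) t i b rewrite +-suc i (length r) = upd-ʳ++ r (x ∷ t) (suc i) b

lendOrBit-ʳ++ : ∀ r x t → LendOrBit (cellAt (r ʳ++ x ∷ t) (length r))
lendOrBit-ʳ++ [] x t = inj₁ refl
lendOrBit-ʳ++ (y ∷ r) x t = inj₂ (y , cellAt′-ʳ++ r (y ∷ x ∷ t) 0)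

zeroOrRend-zeros : ∀ a → ZeroOrRend (cellAt' (zeros a) 0)
zeroOrRend-zeros zero = inj₂ refl
zeroOrRend-zeros (suc a) = inj₁ refl

zeroOrRend-ʳ++ : ∀ r t i a → cellAt' t i ≡ cellAt' (zeros a) 0 → ZeroOrRend (cellAt' (r ʳ++ t) (i + length r))
zeroOrRend-ʳ++ r t i a e = subst ZeroOrRend (sym (trans (cellAt′-ʳ++ r t i) e)) (zeroOrRend-zeros a)

extend : ∀ x r t → stepT₁ down ((x ∷ r) ʳ++ true ∷ false ∷ t) (2 + length r)
  ≡ just (down , (x ∷ r) ʳ++ true ∷ true ∷ t , 3 + length r)
extend x r t =
  trans (rule₂ _ (2 + length r) (lendOrBit-ʳ++ r x _) (cellAt′-ʳ++ r u 0) (cellAt′-ʳ++ r u 1) (cellAt′-ʳ++ r u 2))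
        (cong (λ w → just (down , w , 3 + length r)) (upd-ʳ++ r u 2 true))
  where
  u : List Bool
  u = x ∷ true ∷ false ∷ t

turn : ∀ x r y → stepT₁ down ((x ∷ r) ʳ++ y ∷ true ∷ []) (3 + length r)
  ≡ just (up , (x ∷ r) ʳ++ not y ∷ true ∷ [] , 3 + length r)
turn x r y =
  trans (rule₃ _ (3 + length r) (cellAt′-ʳ++ r u 0) (cellAt′-ʳ++ r u 1) (cellAt′-ʳ++ r u 2) (cellAt′-ʳ++ r u 3))
        (cong (λ w → just (up , w , 3 + length r)) (upd-ʳ++ r u 1 (not y)))
  where
  u : List Bool
  u = x ∷ y ∷ true ∷ []

flip : ∀ p y a → stepT₁ up (p ʳ++ y ∷ false ∷ true ∷ zeros a) (3 + length p)
  ≡ just (down , p ʳ++ not y ∷ false ∷ true ∷ zeros a , 3 + length p)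
flip p y a =
  trans (rule₄ _ (3 + length p) (cellAt′-ʳ++ p u 0) (cellAt′-ʳ++ p u 1) (cellAt′-ʳ++ p u 2) (zeroOrRend-ʳ++ p u 3 a refl))
        (cong (λ w → just (down , w , 3 + length p)) (upd-ʳ++ p u 0 (not y)))
  where
  u : List Bool
  u = y ∷ false ∷ true ∷ zeros a

retract : ∀ x r a → stepT₁ up ((x ∷ r) ʳ++ true ∷ true ∷ zeros a) (3 + length r)
  ≡ just (up , (x ∷ r) ʳ++ true ∷ false ∷ zeros a , 2 + length r)
retract x r a =
  trans (rule₅ _ (3 + length r) (cellAt′-ʳ++ r u 0) (cellAt′-ʳ++ r u 1) (cellAt′-ʳ++ r u 2) (zeroOrRend-ʳ++ r u 3 a refl))
        (cong (λ w → just (up , w , 2 + length r)) (upd-ʳ++ r u 2 false))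
  where
  u : List Bool
  u = x ∷ true ∷ true ∷ zeros a

rev↝ : ∀ a x r → (down , (x ∷ r) ʳ++ lastTail a , 2 + length r)
  ↝⟨ revTrace ((x ∷ r) ʳ++_) a ⟩ (up , (x ∷ r) ʳ++ firstTail a , 3 + length r)
fwd↝ : ∀ a x r → (down , (x ∷ r) ʳ++ firstTail a , 3 + length r)
  ↝⟨ fwdTrace ((x ∷ r) ʳ++_) a ⟩ (up , (x ∷ r) ʳ++ lastTail a , 2 + length r)
rev↝ zero x r = step↝ (extend x r []) ⨾ step↝ (turn x r true)
rev↝ (suc a) x r =
  step↝ (extend x r (zeros (suc a))) ⨾ (rev↝ a true (x ∷ r) ⨾ step↝ (flip (x ∷ r) true a)) ⨾ fwd↝ a false (x ∷ r)
fwd↝ zero x r = step↝ (turn x r false) ⨾ step↝ (retract x r zero)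
fwd↝ (suc a) x r =
  (rev↝ a false (x ∷ r) ⨾ step↝ (flip (x ∷ r) false a)) ⨾ (fwd↝ a true (x ∷ r) ⨾ step↝ (retract x r (suc a)))

run-from-init : ∀ k → initT₁ (3 + k) ↝⟨ zeros (3 + k) ∷ fwdTrace id (suc k) ⟩ (qh , lastTail (suc k) , 1)
run-from-init k =
  step↝ refl ⨾ (rev↝ k false [] ⨾ step↝ (flip [] false k)) ⨾ (fwd↝ k true [] ⨾ step↝ refl)

proposition21 : (ℓ : ℕ) → 3 ≤ ℓ → ∃[ n ] runT₁ n (initT₁ ℓ) ≡ just (B ℓ)
proposition21 (suc (suc (suc k))) (s≤s (s≤s (s≤s _))) =
  map₂ (λ run → trans run (cong (just ∘ (zeros (3 + k) ∷_)) traversal)) (run-from-init k (1 , refl))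
  where
  traversal : fwdTrace id (suc k) ∷ʳ lastTail (suc k) ≡ tailBs (2 + k)
  traversal = trans (fwdTrace-∷ʳ id (suc k)) (map-id _)
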